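{- Let $\mathbb I=\{I_i\}_{i\in0..n}$ be an interface, $D=\bigcup_{I\in\mathbb I}I\times I$ the induced dependency relation, and $o=o_0\parallel\cdots\parallel o_n$ where each $o_i$ is a process with $\mathtt n(o_i)\subseteq I_i$. Then for all $s\in\mathsf{Act}^*$, all $t\in[s]$ and all $o'$: $o\xRightarrow{s}o'$ if and only if $o\xRightarrow{t}o'$.
   Context: Names $\mathcal N$, co-names $\bar a$ ($\bar{\bar a}=a$), $\mathsf{Act}=\mathcal N\cup\bar{\mathcal N}$, internal action $\tau\notin\mathsf{Act}$, success $\checkmark$. Processes: $p::=\mathbf 0\mid\mathbf 1\mid\mu.p\mid p+q\mid X\mid \mathrm{rec}_X.p$ ($\mu\in\mathsf{Act}\cup\{\tau\}$), transitions $\mathbf 1\xrightarrow{\checkmark}\mathbf 0$, $\mu.p\xrightarrow{\mu}p$, choice moving as either summand, recursion unfolded. Configurations $c::=p\mid c\parallel d$: either side may move alone with $\mu\in\mathsf{Act}\cup\{\tau\}$; $c\parallel d\xrightarrow{\tau}c'\parallel d'$ if $c\xrightarrow{\alpha}c'$, $d\xrightarrow{\bar\alpha}d'$; $c\parallel d\xrightarrow{\checkmark}c'\parallel d'$ if both sides do $\checkmark$. $\mathtt n(p)$: names $a$ with $a$ or $\bar a$ occurring in $p$; $\mathtt n(o_i)\subseteq I_i$ means every such name lies in $I_i$. $\Rightarrow$: reflexive-transitive closure of $\xrightarrow{\tau}$; $c\xRightarrow{\lambda}c'$ means $c\Rightarrow\xrightarrow{\lambda}\Rightarrow c'$, extended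 to strings by composition. An interface is a partition $\mathbb I=\{I_i\}_{i\in0..n}$ of $\mathsf{Act}$ with $\alpha\in I_i\Rightarrow\bar\alpha\in I_i$. $\equiv_D$ is the least congruence on $\mathsf{Act}^*$ with $\alpha\beta\equiv_D\beta\alpha$ whenever $(\alpha,\beta)\notin D$; $[s]$ is the $\equiv_D$-class of $s$. -}

module Defs where

open import Data.Nat using (ℕ; zero; suc; _≡ᵇ_)
open import Data.Bool using (if_then_else_)
open import Data.Fin using (Fin; zero; suc)
open import Data.List using (List; []; _∷_; _++_)
open import Data.Product using (Σ; ∃; _×_; _,_)
open import Data.List.Relation.Unary.All using (All)
open import Relation.Binary.PropositionalEquality using (_≡_)
open import Relation.Binary.Construct.Closure.ReflexiveTransitive using (Star)
open import Relation.Nullary using (¬_)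

data Act (N : Set) : Set where
  nm : N → Act N
  co : N → Act N

bar : ∀ {N} → Act N → Act N
bar (nm a) = co a
bar (co a) = nm a

data Pre (N : Set) : Set where
  act : Act N → Pre N
  tau : Pre N

data Lab (N : Set) : Set where
  lact : Act N → Lab N
  lτ   : Lab N
  l✓   : Lab N

preLab : ∀ {N} → Pre N → Lab N
preLab (act α) = lact α
preLab tau     = lτ

Var : Set
Var = ℕ

data Proc (N : Set) : Set where
  𝟘    : Proc N
  𝟙    : Proc N
  _·_  : Pre N → Proc N → Proc N
  _⊕_  : Proc N → Proc N → Proc N
  var  : Var → Proc N
  rec  : Var → Proc N → Proc N

_[_/_] : ∀ {N} → Proc N → Proc N → Var → Proc N
𝟘 [ q / X ] = 𝟘
𝟙 [ q / X ] = 𝟙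
(μ · p) [ q / X ] = μ · (p [ q / X ])
(p ⊕ r) [ q / X ] = (p [ q / X ]) ⊕ (r [ q / X ])
var Y [ q / X ] = if X ≡ᵇ Y then q else var Y
rec Y p [ q / X ] = if X ≡ᵇ Y then rec Y p else rec Y (p [ q / X ])

data _—[_]→_ {N : Set} : Proc N → Lab N → Proc N → Set where
  succ : 𝟙 —[ l✓ ]→ 𝟘
  pref : ∀ {μ p} → (μ · p) —[ preLab μ ]→ p
  sumL : ∀ {p q l p'} → p —[ l ]→ p' → (p ⊕ q) —[ l ]→ p'
  sumR : ∀ {p q l q'} → q —[ l ]→ q' → (p ⊕ q) —[ l ]→ q'
  unf  : ∀ {X p l p'} → (p [ rec X p / X ]) —[ l ]→ p' → rec X p —[ l ]→ p'

names : ∀ {N} → Proc N → List N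
names 𝟘 = []
names 𝟙 = []
names (act (nm a) · p) = a ∷ names p
names (act (co a) · p) = a ∷ names p
names (tau · p) = names p
names (p ⊕ q) = names p ++ names q
names (var X) = []
names (rec X p) = names p

data Conf (N : Set) : Set where
  proc : Proc N → Conf N
  _∥_  : Conf N → Conf N → Conf N

data _═[_]⇒_ {N : Set} : Conf N → Lab N → Conf N → Set where
  base : ∀ {p l p'} → p —[ l ]→ p' → proc p ═[ l ]⇒ proc p'
  parL : ∀ {c d μ c'} → c ═[ preLab μ ]⇒ c' → (c ∥ d) ═[ preLab μ ]⇒ (c' ∥ d)
  parR : ∀ {c d μ d'} → d ═[ preLab μ ]⇒ d' → (c ∥ d) ═[ preLab μ ]⇒ (c ∥ d')
  sync : ∀ {c d α c' d'} → c ═[ lact α ]⇒ c' → d ═[ lact (bar α) ]⇒ d' →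
         (c ∥ d) ═[ lτ ]⇒ (c' ∥ d')
  both✓ : ∀ {c d c' d'} → c ═[ l✓ ]⇒ c' → d ═[ l✓ ]⇒ d' →
         (c ∥ d) ═[ l✓ ]⇒ (c' ∥ d')

_⟹_ : ∀ {N} → Conf N → Conf N → Set
_⟹_ = Star (λ c c' → c ═[ lτ ]⇒ c')

_⟹[_]_ : ∀ {N} → Conf N → List (Act N) → Conf N → Set
c ⟹[ [] ] c' = c ⟹ c'
c ⟹[ α ∷ s ] c' = ∃ λ c₁ → ∃ λ c₂ → ∃ λ c₃ →
  (c ⟹ c₁) × (c₁ ═[ lact α ]⇒ c₂) × (c₂ ⟹ c₃) × (c₃ ⟹[ s ] c')

-- Interface: partition {I_i}_{i∈0..n} of Act, given by the block map;
-- blocks are nonempty and closed under complementation.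
record Interface (N : Set) (n : ℕ) : Set where
  field
    blk      : Act N → Fin (suc n)
    blk-bar  : ∀ α → blk (bar α) ≡ blk α
    nonempty : ∀ i → ∃ λ α → blk α ≡ i

Dep : ∀ {N n} → Interface N n → Act N → Act N → Set
Dep 𝕀 α β = Interface.blk 𝕀 α ≡ Interface.blk 𝕀 β

-- ≡_D : least congruence on Act* with αβ ≡ βα for (α,β) ∉ D
data _≈[_]_ {N : Set} (s : List (Act N)) (D : Act N → Act N → Set) : List (Act N) → Set where
  ≈refl : s ≈[ D ] s
  ≈step : ∀ u v α β → ¬ D α β → s ≈[ D ] (u ++ α ∷ β ∷ v) →
          s ≈[ D ] (u ++ β ∷ α ∷ v)

system : ∀ {N} n → (Fin (suc n) → Proc N) → Conf N
system zero o = proc (o zero)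
system (suc n) o = proc (o zero) ∥ system n (λ i → o (suc i))

namesIn : ∀ {N n} → Interface N n → Proc N → Fin (suc n) → Set
namesIn 𝕀 p i = All (λ a → Interface.blk 𝕀 (nm a) ≡ i) (names p)

-- Each component o_i only performs actions of its own block I_i, and since I_i is closed
-- under complementation no two components can synchronise.  Hence a weak trace of o on s
-- splits into weak traces of the components, the one of o_i on the projection of s onto
-- I_i, and conversely such component traces interleave into a trace of o on any word with
-- these projections.  Projection onto a block respects ≡_D, and on words inside a single
-- block ≡_D is equality, because all their actions depend on each other.  So s and t have
-- the same projections, and the trace of o on s can be rebuilt along t.
module Submission where

open import Defs
open import Data.Nat using (ℕ; zero; suc; _≡ᵇ_)
open import Data.Bool using (true; false)
open import Data.Fin using (Fin; zero; suc)
open import Data.Fin.Properties using (_≟_; suc-injective)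
open import Data.List using (List; []; _∷_; _++_; filter; [_]; tabulate)
open import Data.List.Properties using (filter-accept; filter-reject)
open import Data.List.Relation.Unary.All using (All; []; _∷_)
open import Data.List.Relation.Unary.All.Properties using (++⁺; ++⁻ˡ; ++⁻ʳ)
open import Data.List.Relation.Unary.Any using (here; there)
open import Data.List.Membership.Propositional using (_∈_; _∉_)
open import Data.List.Membership.Propositional.Properties using (∈-tabulate⁻)
open import Data.Product using (_,_)
open import Data.Unit using (⊤; tt)
open import Data.Empty using (⊥-elim)
open import Function using (_∘_)
open import Function.Definitions using (Injective)
open import Function.Bundles using (_⇔_; mk⇔)
open import Relation.Nullary using (¬_; yes; no)
open import Relation.Unary using (Decidable)
open import Relation.Unary.Properties using (∁?)
open import Relation.Binary.Definitions using (Symmetric)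
open import Relation.Binary.PropositionalEquality using (_≡_; _≢_; refl; sym; trans; subst)
open import Relation.Binary.Construct.Closure.ReflexiveTransitive using (ε; _◅_; _◅◅_; gmap)

module _ {N : Set} {D : Act N → Act N → Set} where

  ≈-trans : ∀ {s w t} → s ≈[ D ] w → w ≈[ D ] t → s ≈[ D ] t
  ≈-trans r ≈refl                  = r
  ≈-trans r (≈step u v α β nd r′) = ≈step u v α β nd (≈-trans r r′)

  ≈-swap : ∀ u v {α β} → ¬ D α β → (u ++ α ∷ β ∷ v) ≈[ D ] (u ++ β ∷ α ∷ v)
  ≈-swap u v nd = ≈step u v _ _ nd ≈refl

  ≈-sym : Symmetric D → ∀ {s t} → s ≈[ D ] t → t ≈[ D ] s
  ≈-sym D-sym ≈refl                 = ≈refl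
  ≈-sym D-sym (≈step u v α β nd r) = ≈-trans (≈-swap u v (nd ∘ D-sym)) (≈-sym D-sym r)

  ≈-∷ : ∀ x {s t} → s ≈[ D ] t → (x ∷ s) ≈[ D ] (x ∷ t)
  ≈-∷ x ≈refl                 = ≈refl
  ≈-∷ x (≈step u v α β nd r) = ≈step (x ∷ u) v α β nd (≈-∷ x r)

  module _ {P : Act N → Set} (P? : Decidable P) where

    filter-swap-≈ : ∀ u v {α β} → ¬ D α β →
                    filter P? (u ++ α ∷ β ∷ v) ≈[ D ] filter P? (u ++ β ∷ α ∷ v)
    -- `with` only abstracts the outer decisions; the inner filter steps are rewritten.
    filter-swap-≈ [] v {α} {β} nd with P? α | P? β
    ... | yes pα | yes pβ
      rewrite filter-accept P? {xs = v} pα | filter-accept P? {xs = v} pβ = ≈-swap [] (filter P? v) nd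
    ... | yes pα | no ¬pβ
      rewrite filter-accept P? {xs = v} pα | filter-reject P? {xs = v} ¬pβ = ≈refl
    ... | no ¬pα | yes pβ
      rewrite filter-reject P? {xs = v} ¬pα | filter-accept P? {xs = v} pβ = ≈refl
    ... | no ¬pα | no ¬pβ
      rewrite filter-reject P? {xs = v} ¬pα | filter-reject P? {xs = v} ¬pβ = ≈refl
    filter-swap-≈ (x ∷ u) v nd with P? x
    ... | yes _ = ≈-∷ x (filter-swap-≈ u v nd)
    ... | no _  = filter-swap-≈ u v nd

    filter-≈ : ∀ {s t} → s ≈[ D ] t → filter P? s ≈[ D ] filter P? t
    filter-≈ ≈refl                 = ≈refl
    filter-≈ (≈step u v α β nd r) = ≈-trans (filter-≈ r) (filter-swap-≈ u v nd)

  ≈-clique⇒≡ : {P : Act N → Set} → (∀ {α β} → P α → P β → D α β) →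
               ∀ {s t} → All P s → s ≈[ D ] t → t ≡ s
  ≈-clique⇒≡ clique ps ≈refl = refl
  ≈-clique⇒≡ clique ps (≈step u v α β nd r) with ≈-clique⇒≡ clique ps r
  ... | refl with ++⁻ʳ u ps
  ... | pα ∷ pβ ∷ _ = ⊥-elim (nd (clique pα pβ))

module _ {N : Set} where

  data Run : Conf N → List (Act N) → Conf N → Set where
    done    : ∀ {c} → Run c [] c
    silent  : ∀ {c c₁ s e} → c ═[ lτ ]⇒ c₁ → Run c₁ s e → Run c s e
    visible : ∀ {c c₁ α s e} → c ═[ lact α ]⇒ c₁ → Run c₁ s e → Run c (α ∷ s) e

  ⟹-Run : ∀ {c c₁ : Conf N} {s e} → c ⟹ c₁ → Run c₁ s e → Run c s e
  ⟹-Run ε        ρ = ρ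
  ⟹-Run (x ◅ xs) ρ = silent x (⟹-Run xs ρ)

  ⟹[]⇒Run : ∀ s {c e : Conf N} → c ⟹[ s ] e → Run c s e
  ⟹[]⇒Run []      τs = ⟹-Run τs done
  ⟹[]⇒Run (α ∷ s) (_ , _ , _ , τs₁ , x , τs₂ , w) =
    ⟹-Run τs₁ (visible x (⟹-Run τs₂ (⟹[]⇒Run s w)))

  ◅-⟹[] : ∀ s {c c₁ e : Conf N} → c ═[ lτ ]⇒ c₁ → c₁ ⟹[ s ] e → c ⟹[ s ] e
  ◅-⟹[] []      x τs                       = x ◅ τs
  ◅-⟹[] (α ∷ s) x (c₁ , c₂ , c₃ , τs₁ , w) = c₁ , c₂ , c₃ , x ◅ τs₁ , w

  Run⇒⟹[] : ∀ {c s e} → Run c s e → c ⟹[ s ] e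
  Run⇒⟹[]         done          = ε
  Run⇒⟹[] {s = s} (silent x ρ)  = ◅-⟹[] s x (Run⇒⟹[] ρ)
  Run⇒⟹[]         (visible x ρ) = _ , _ , _ , ε , x , ε , Run⇒⟹[] ρ

  ∥-⟹ˡ : ∀ {c c′ d : Conf N} → c ⟹ c′ → (c ∥ d) ⟹ (c′ ∥ d)
  ∥-⟹ˡ = gmap _ (parL {μ = tau})

  ∥-⟹ʳ : ∀ {c d d′ : Conf N} → d ⟹ d′ → (c ∥ d) ⟹ (c ∥ d′)
  ∥-⟹ʳ = gmap _ (parR {μ = tau})

  module _ {P : Act N → Set} (P? : Decidable P) where

    ∥-⟹[] : ∀ s {c c′ d d′ : Conf N} → c ⟹[ filter P? s ] c′ → d ⟹[ filter (∁? P?) s ] d′ →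
             (c ∥ d) ⟹[ s ] (c′ ∥ d′)
    ∥-⟹[] [] τsᶜ τsᵈ = ∥-⟹ˡ τsᶜ ◅◅ ∥-⟹ʳ τsᵈ
    ∥-⟹[] (α ∷ s) wᶜ wᵈ with P? α
    ∥-⟹[] (α ∷ s) {d = d} (c₁ , c₂ , c₃ , τs₁ , x , τs₂ , wᶜ) wᵈ | yes _ =
      (c₁ ∥ d) , (c₂ ∥ d) , (c₃ ∥ d) , ∥-⟹ˡ τs₁ , parL {μ = act α} x , ∥-⟹ˡ τs₂ , ∥-⟹[] s wᶜ wᵈ
    ∥-⟹[] (α ∷ s) {c = c} wᶜ (d₁ , d₂ , d₃ , τs₁ , x , τs₂ , wᵈ) | no _ =
      (c ∥ d₁) , (c ∥ d₂) , (c ∥ d₃) , ∥-⟹ʳ τs₁ , parR {μ = act α} x , ∥-⟹ʳ τs₂ , ∥-⟹[] s wᶜ wᵈ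

    visible-accept : ∀ {c c₁ α s e} → P α → c ═[ lact α ]⇒ c₁ → Run c₁ (filter P? s) e →
                     Run c (filter P? (α ∷ s)) e
    visible-accept pα x ρ = subst (λ u → Run _ u _) (sym (filter-accept P? pα)) (visible x ρ)

    Run-reject : ∀ {c α s e} → ¬ P α → Run c (filter P? s) e → Run c (filter P? (α ∷ s)) e
    Run-reject ¬pα ρ = subst (λ u → Run _ u _) (sym (filter-reject P? ¬pα)) ρ

    ∥-Run : ∀ s {c c′ d d′} → Run c (filter P? s) c′ → Run d (filter (∁? P?) s) d′ →
            Run (c ∥ d) s (c′ ∥ d′)
    ∥-Run s ρᶜ ρᵈ = ⟹[]⇒Run s (∥-⟹[] s (Run⇒⟹[] ρᶜ) (Run⇒⟹[] ρᵈ))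

All-names-[/] : ∀ {N} {P : N → Set} p q X →
                All P (names p) → All P (names q) → All P (names (p [ q / X ]))
All-names-[/] 𝟘                q X ps qs = []
All-names-[/] 𝟙                q X ps qs = []
All-names-[/] (act (nm a) · p) q X (pa ∷ ps) qs = pa ∷ All-names-[/] p q X ps qs
All-names-[/] (act (co a) · p) q X (pa ∷ ps) qs = pa ∷ All-names-[/] p q X ps qs
All-names-[/] (tau · p)        q X ps qs = All-names-[/] p q X ps qs
All-names-[/] (p ⊕ r)          q X ps qs =
  ++⁺ (All-names-[/] p q X (++⁻ˡ (names p) ps) qs) (All-names-[/] r q X (++⁻ʳ (names p) ps) qs)
All-names-[/] (var Y)          q X ps qs with X ≡ᵇ Y
... | true  = qs
... | false = []
All-names-[/] (rec Y p)        q X ps qs with X ≡ᵇ Y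
... | true  = ps
... | false = All-names-[/] p q X ps qs

module _ {N : Set} {m : ℕ} (𝕀 : Interface N m) where
  open Interface 𝕀

  Block : Set
  Block = Fin (suc m)

  LabelIn : (Block → Set) → Lab N → Set
  LabelIn B (lact α) = B (blk α)
  LabelIn B lτ       = ⊤
  LabelIn B l✓       = ⊤

  LabelIn-map : ∀ {B C : Block → Set} → (∀ {k} → B k → C k) → ∀ l → LabelIn B l → LabelIn C l
  LabelIn-map f (lact α) b = f b
  LabelIn-map f lτ       b = tt
  LabelIn-map f l✓       b = tt

  module _ {k : Block} where

    step-namesIn : ∀ {p l p′} → namesIn 𝕀 p k → p —[ l ]→ p′ → namesIn 𝕀 p′ k
    step-namesIn                  ns       succ     = []
    step-namesIn {act (nm a) · p} (_ ∷ ns) pref     = ns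
    step-namesIn {act (co a) · p} (_ ∷ ns) pref     = ns
    step-namesIn {tau · p}        ns       pref     = ns
    step-namesIn {p ⊕ q}          ns       (sumL x) = step-namesIn (++⁻ˡ (names p) ns) x
    step-namesIn {p ⊕ q}          ns       (sumR x) = step-namesIn (++⁻ʳ (names p) ns) x
    step-namesIn {rec X p}        ns       (unf x)  = step-namesIn (All-names-[/] p (rec X p) X ns ns) x

    step-label : ∀ {p l p′} → namesIn 𝕀 p k → p —[ l ]→ p′ → LabelIn (_≡ k) l
    step-label                  ns       succ     = tt
    step-label {act (nm a) · p} (na ∷ _) pref     = na
    step-label {act (co a) · p} (na ∷ _) pref     = trans (blk-bar (nm a)) na
    step-label {tau · p}        ns       pref     = tt
    step-label {p ⊕ q}          ns       (sumL x) = step-label (++⁻ˡ (names p) ns) x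
    step-label {p ⊕ q}          ns       (sumR x) = step-label (++⁻ʳ (names p) ns) x
    step-label {rec X p}        ns       (unf x)  = step-label (All-names-[/] p (rec X p) X ns ns) x

  -- The shape of every configuration reachable from o: processes in pairwise distinct blocks.
  data Distributed : List Block → Conf N → Set where
    solo : ∀ {k p} → namesIn 𝕀 p k → Distributed [ k ] (proc p)
    par  : ∀ {k ks p d} → namesIn 𝕀 p k → k ∉ ks → Distributed ks d →
           Distributed (k ∷ ks) (proc p ∥ d)

  step-Distributed : ∀ {ks c l c′} → Distributed ks c → c ═[ l ]⇒ c′ → Distributed ks c′
  step-Distributed (solo ns)     (base x)           = solo (step-namesIn ns x)
  step-Distributed (par ns k∉ δ) (parL (base x))    = par (step-namesIn ns x) k∉ δ
  step-Distributed (par ns k∉ δ) (parR y)           = par ns k∉ (step-Distributed δ y)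
  step-Distributed (par ns k∉ δ) (sync (base x) y)  = par (step-namesIn ns x) k∉ (step-Distributed δ y)
  step-Distributed (par ns k∉ δ) (both✓ (base x) y) = par (step-namesIn ns x) k∉ (step-Distributed δ y)

  step-label-Distributed : ∀ {ks c l c′} → Distributed ks c → c ═[ l ]⇒ c′ → LabelIn (_∈ ks) l
  step-label-Distributed {l = l} (solo ns)     (base x)        = LabelIn-map here l (step-label ns x)
  step-label-Distributed {l = l} (par ns k∉ δ) (parL (base x)) = LabelIn-map here l (step-label ns x)
  step-label-Distributed {l = l} (par ns k∉ δ) (parR y)        =
    LabelIn-map there l (step-label-Distributed δ y)
  step-label-Distributed         (par ns k∉ δ) (sync x y)      = tt
  step-label-Distributed         (par ns k∉ δ) (both✓ x y)     = tt

  data ParStep (p : Proc N) (d : Conf N) (l : Lab N) : Conf N → Set where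
    left  : ∀ {p′} → p —[ l ]→ p′ → ParStep p d l (proc p′ ∥ d)
    right : ∀ {d′} → d ═[ l ]⇒ d′ → ParStep p d l (proc p ∥ d′)

  -- A synchronisation would need a co-action of block k inside d.
  par-step : ∀ {k ks p d l e} → namesIn 𝕀 p k → k ∉ ks → Distributed ks d → l ≢ l✓ →
             (proc p ∥ d) ═[ l ]⇒ e → ParStep p d l e
  par-step ns k∉ δ l≢✓ (parL (base x)) = left x
  par-step ns k∉ δ l≢✓ (parR y)        = right y
  par-step {ks = ks} ns k∉ δ l≢✓ (sync {α = α} (base x) y) =
    ⊥-elim (k∉ (subst (_∈ ks) (trans (blk-bar α) (step-label ns x)) (step-label-Distributed δ y)))
  par-step ns k∉ δ l≢✓ (both✓ _ _)     = ⊥-elim (l≢✓ refl)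

  InBlock? : (k : Block) → Decidable (λ α → blk α ≡ k)
  InBlock? k α = blk α ≟ k

  data SplitRun (k : Block) (p : Proc N) (d : Conf N) (s : List (Act N)) : Conf N → Set where
    _∥ʳ_ : ∀ {p′ d′} → Run (proc p) (filter (InBlock? k) s) (proc p′) →
           Run d (filter (∁? (InBlock? k)) s) d′ → SplitRun k p d s (proc p′ ∥ d′)

  split-Run : ∀ {k ks p d s e} → namesIn 𝕀 p k → k ∉ ks → Distributed ks d →
              Run (proc p ∥ d) s e → SplitRun k p d s e
  split-Run ns k∉ δ done = done ∥ʳ done
  split-Run ns k∉ δ (silent x ρ) with par-step ns k∉ δ (λ ()) x
  ... | left x′ with split-Run (step-namesIn ns x′) k∉ δ ρ
  ...   | ρᵖ ∥ʳ ρᵈ = silent (base x′) ρᵖ ∥ʳ ρᵈ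
  split-Run ns k∉ δ (silent x ρ) | right y with split-Run ns k∉ (step-Distributed δ y) ρ
  ...   | ρᵖ ∥ʳ ρᵈ = ρᵖ ∥ʳ silent y ρᵈ
  split-Run {k} ns k∉ δ (visible x ρ) with par-step ns k∉ δ (λ ()) x
  ... | left x′ with split-Run (step-namesIn ns x′) k∉ δ ρ
  ...   | ρᵖ ∥ʳ ρᵈ = visible-accept (InBlock? k) α∈k (base x′) ρᵖ
                  ∥ʳ Run-reject (∁? (InBlock? k)) (λ α∉k → α∉k α∈k) ρᵈ
    where α∈k = step-label ns x′
  split-Run {k} {ks} ns k∉ δ (visible x ρ) | right y with split-Run ns k∉ (step-Distributed δ y) ρ
  ...   | ρᵖ ∥ʳ ρᵈ = Run-reject (InBlock? k) α∉k ρᵖ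
                  ∥ʳ visible-accept (∁? (InBlock? k)) α∉k y ρᵈ
    where α∉k = λ α∈k → k∉ (subst (_∈ ks) α∈k (step-label-Distributed δ y))

  Run-labels : ∀ {k p s e} → namesIn 𝕀 p k → Run (proc p) s e → All (λ α → blk α ≡ k) s
  Run-labels ns done                 = []
  Run-labels ns (silent (base x) ρ)  = Run-labels (step-namesIn ns x) ρ
  Run-labels ns (visible (base x) ρ) = step-label ns x ∷ Run-labels (step-namesIn ns x) ρ

  proc-Run-≈ : ∀ {k p s t e} → namesIn 𝕀 p k → s ≈[ Dep 𝕀 ] t → Run (proc p) s e → Run (proc p) t e
  proc-Run-≈ ns s≈t ρ =
    subst (λ u → Run _ u _) (sym (≈-clique⇒≡ (λ αk βk → trans αk (sym βk)) (Run-labels ns ρ) s≈t)) ρ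

  Distributed-Run-≈ : ∀ {ks c s t e} → Distributed ks c → s ≈[ Dep 𝕀 ] t → Run c s e → Run c t e
  Distributed-Run-≈ (solo ns) s≈t ρ = proc-Run-≈ ns s≈t ρ
  Distributed-Run-≈ {t = t} (par {k} ns k∉ δ) s≈t ρ with split-Run ns k∉ δ ρ
  ... | ρᵖ ∥ʳ ρᵈ = ∥-Run (InBlock? k) t (proc-Run-≈ ns (filter-≈ (InBlock? k) s≈t) ρᵖ)
                                        (Distributed-Run-≈ δ (filter-≈ (∁? (InBlock? k)) s≈t) ρᵈ)

  system-Distributed : ∀ n (o : Fin (suc n) → Proc N) (b : Fin (suc n) → Block) →
                       Injective _≡_ _≡_ b → (∀ i → namesIn 𝕀 (o i) (b i)) →
                       Distributed (tabulate b) (system n o)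
  system-Distributed zero    o b b-inj ns = solo (ns zero)
  system-Distributed (suc n) o b b-inj ns =
    par (ns zero) b₀∉
        (system-Distributed n (o ∘ suc) (b ∘ suc) (λ bᵢ≡bⱼ → suc-injective (b-inj bᵢ≡bⱼ)) (ns ∘ suc))
    where
    b₀∉ : b zero ∉ tabulate (b ∘ suc)
    b₀∉ b₀∈ with ∈-tabulate⁻ b₀∈
    ... | i , b₀≡bᵢ with b-inj {y = suc i} b₀≡bᵢ
    ... | ()

lemma3p5 : {N : Set} {n : ℕ} (𝕀 : Interface N n) (o : Fin (suc n) → Proc N) →
           (∀ i → namesIn 𝕀 (o i) i) →
           (s t : List (Act N)) → s ≈[ Dep 𝕀 ] t → (o' : Conf N) →
           ((system n o ⟹[ s ] o') ⇔ (system n o ⟹[ t ] o'))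
lemma3p5 {n = n} 𝕀 o ns s t s≈t o' = mk⇔ (transfer s≈t) (transfer (≈-sym sym s≈t))
  where
  transfer : ∀ {s t} → s ≈[ Dep 𝕀 ] t → system n o ⟹[ s ] o' → system n o ⟹[ t ] o'
  transfer s≈t = Run⇒⟹[] ∘ Distributed-Run-≈ 𝕀 o-Distributed s≈t ∘ ⟹[]⇒Run _
    where
    o-Distributed : Distributed 𝕀 (tabulate (λ i → i)) (system n o)
    o-Distributed = system-Distributed 𝕀 n o (λ i → i) (λ i≡j → i≡j) ns
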